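{- For all integers $n \geq 3$, $bend_p(K^3_n) \leq 2n+4$.
   Context: For $n > k$, $K^k_n$ is the split graph whose vertex set is partitioned into a clique $C$ with $n$ vertices and an independent set $I$ with $\binom{n}{k}$ vertices such that for every $k$-element subset $C' \subseteq C$ there is a unique vertex $u \in I$ with $N(u) = C'$. A path is a simple, piecewise linear curve in the plane made up of alternating horizontal and vertical segments; a $k$-bend path has at most $k+1$ segments. A $B_k$-VPG representation of a graph is a collection of $k$-bend paths, one per vertex, such that two paths intersect iff the vertices are adjacent; it is proper ($PB_k$-VPG) if any two paths have finitely many intersection points, each intersection point belongs to exactly two paths, and intersecting paths cross each other. The proper bend number $bend_p(G)$ is the minimum $k$ such that $G$ has a $PB_k$-VPG representation. -}

module Defs where

open import Data.Nat as ℕ using (ℕ; zero; suc; _+_; _*_)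
open import Data.Integer as ℤ using (ℤ)
open import Data.Fin using (Fin; toℕ)
open import Data.Fin.Subset as Sub using (Subset; ∣_∣)
open import Data.List using (List; []; _∷_; length; lookup)
open import Data.List.Relation.Unary.Any using (Any)
open import Data.List.Relation.Unary.All using (All)
open import Data.List.Membership.Propositional using (_∈_)
open import Data.Product using (Σ; ∃; _×_; _,_; proj₁; proj₂)
open import Data.Sum using (_⊎_; inj₁; inj₂)
open import Data.Empty using (⊥)
open import Data.Unit using (⊤)
open import Relation.Nullary using (¬_)
open import Relation.Binary.PropositionalEquality using (_≡_; _≢_)

record Graph : Set₁ where
  field
    V   : Set
    Adj : V → V → Set

-- Vertices: inj₁ i  for i ∈ C = Fin n (the clique),
--           inj₂ (S , _) for each k-element subset S ⊆ C (the independent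
--           set; exactly one vertex per k-subset), with N(inj₂ S) = S.

KV : ℕ → ℕ → Set
KV k n = Fin n ⊎ Σ (Subset n) (λ S → ∣ S ∣ ≡ k)

KAdj : (k n : ℕ) → KV k n → KV k n → Set
KAdj k n (inj₁ i) (inj₁ j) = i ≢ j
KAdj k n (inj₁ i) (inj₂ (S , _)) = i Sub.∈ S
KAdj k n (inj₂ (S , _)) (inj₁ i) = i Sub.∈ S
KAdj k n (inj₂ _) (inj₂ _) = ⊥

K : ℕ → ℕ → Graph
K k n = record { V = KV k n ; Adj = KAdj k n }

Point : Set
Point = ℤ × ℤ

X Y : Point → ℤ
X = proj₁
Y = proj₂

Segment : Set
Segment = Point × Point

Between : ℤ → ℤ → ℤ → Set
Between a b c = (a ℤ.≤ c × c ℤ.≤ b) ⊎ (b ℤ.≤ c × c ℤ.≤ a)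

StrictlyBetween : ℤ → ℤ → ℤ → Set
StrictlyBetween a b c = (a ℤ.< c × c ℤ.< b) ⊎ (b ℤ.< c × c ℤ.< a)

Horizontal : Segment → Set
Horizontal (a , b) = Y a ≡ Y b × X a ≢ X b

Vertical : Segment → Set
Vertical (a , b) = X a ≡ X b × Y a ≢ Y b

OnSeg : Point → Segment → Set
OnSeg p (a , b) =
  (Y p ≡ Y a × Y a ≡ Y b × Between (X a) (X b) (X p)) ⊎
  (X p ≡ X a × X a ≡ X b × Between (Y a) (Y b) (Y p))

InSegInterior : Point → Segment → Set
InSegInterior p (a , b) =
  (Y p ≡ Y a × Y a ≡ Y b × StrictlyBetween (X a) (X b) (X p)) ⊎
  (X p ≡ X a × X a ≡ X b × StrictlyBetween (Y a) (Y b) (Y p))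

segs : List Point → List Segment
segs (p ∷ q ∷ r) = (p , q) ∷ segs (q ∷ r)
segs _ = []

Alternating : List Segment → Set
Alternating (s ∷ t ∷ r) =
  ((Horizontal s × Vertical t) ⊎ (Vertical s × Horizontal t)) × Alternating (t ∷ r)
Alternating _ = ⊤

-- simple: the curve passes through no point twice, i.e. two distinct
-- segments only meet when consecutive, and then only at their common vertex
Simple : List Segment → Set
Simple ss = (i j : Fin (length ss)) (p : Point) → toℕ i ℕ.< toℕ j →
  OnSeg p (lookup ss i) → OnSeg p (lookup ss j) →
  (toℕ j ≡ suc (toℕ i)) × (p ≡ proj₂ (lookup ss i))

record GridPath : Set where
  field
    pts         : List Point
    nonTrivial  : 2 ℕ.≤ length pts
    axisParallel : All (λ s → Horizontal s ⊎ Vertical s) (segs pts)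
    alternating : Alternating (segs pts)
    simple      : Simple (segs pts)
open GridPath public

nSegs : GridPath → ℕ
nSegs P = length (segs (pts P))

IsKBend : ℕ → GridPath → Set
IsKBend k P = nSegs P ℕ.≤ k + 1

OnPath : Point → GridPath → Set
OnPath p P = Any (OnSeg p) (segs (pts P))

Intersect : GridPath → GridPath → Set
Intersect P Q = ∃ λ p → OnPath p P × OnPath p Q

-- P and Q cross at p: p is an interior point of a segment of each path
-- (so not a bend point or endpoint of either), and these two segments
-- are one horizontal and one vertical, so the curves pass through each other.
CrossAt : Point → GridPath → GridPath → Set
CrossAt p P Q =
  Any (λ s → Any (λ t → InSegInterior p s × InSegInterior p t ×
                   ((Horizontal s × Vertical t) ⊎ (Vertical s × Horizontal t)))
                 (segs (pts Q)))
      (segs (pts P))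

record PBkVPG (k : ℕ) (G : Graph) : Set where
  open Graph G
  field
    path : V → GridPath
    kBend : ∀ v → IsKBend k (path v)
    intersect⇒adj : ∀ u v → u ≢ v → Intersect (path u) (path v) → Adj u v
    adj⇒intersect : ∀ u v → u ≢ v → Adj u v → Intersect (path u) (path v)
    finiteIntersections : ∀ u v → u ≢ v →
      ∃ λ (L : List Point) → ∀ p → OnPath p (path u) → OnPath p (path v) → p ∈ L
    exactlyTwo : ∀ u v w p → u ≢ v → u ≢ w → v ≢ w →
      OnPath p (path u) → OnPath p (path v) → ¬ OnPath p (path w)
    crossing : ∀ u v p → u ≢ v →
      OnPath p (path u) → OnPath p (path v) → CrossAt p (path u) (path v)

-- bend_p(G) ≤ k  iff  G has a PB_k-VPG representation
-- (PB_j ⊆ PB_k for j ≤ k since a j-bend path is a k-bend path)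
BendP≤ : Graph → ℕ → Set
BendP≤ G k = PBkVPG k G

-- The clique vertex i is drawn as a staircase through the diagonal points
-- (level E i, level E i), E = 1, …, n + 1.  The order of the clique by level E
-- changes with E: level 2m+1 orders it by (i mod (m+1), i div (m+1)) and level
-- 2m+2 by the reverse order.  For three vertices x < y < z the closer of the
-- pairs (x, y), (y, z) has a gap d with 2d ≤ n, so at level 2d−1 or 2d it is
-- consecutive, say a then b, with the third vertex c before a.  The independent
-- vertex {a, b, c} is then a 2-bend path squeezed between the level-E
-- coordinates of c, a and b, crossing the staircases of a, b and c and no
-- other.  Coordinates are triples (slot, offset, tag) read lexicographically,
-- and corners of distinct paths never share a coordinate, so two paths meet
-- only where a horizontal segment of one crosses a vertical segment of the
-- other: the representation is proper.  A staircase has 2n + 2 segments.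

module Submission where

open import Defs
open import Data.Bool using (Bool; true; false)
open import Data.Empty using (⊥; ⊥-elim)
open import Data.Fin as Fin using (Fin; zero; suc; toℕ; opposite; combine; #_)
open import Data.Fin.Properties as Fin using (toℕ<n; toℕ-injective; opposite-prop)
open import Data.Fin.Subset as Subset using (Subset; ∣_∣; inside; outside)
open import Data.Integer as ℤ using (ℤ; +_; +≤+)
open import Data.Integer.Properties as ℤ using ()
open import Data.List using (List; []; _∷_; length; lookup; map; _++_; cartesianProduct)
open import Data.List.Membership.Propositional using (_∈_; _∉_; find; lose)
open import Data.List.Membership.Propositional.Properties
  using (∈-lookup; ∈-map⁺; ∈-map⁻; ∈-++⁺ˡ; ∈-++⁺ʳ; ∈-cartesianProduct⁺)
open import Data.List.Properties using (length-map)
open import Data.List.Relation.Unary.All as All using (All; []; _∷_)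
import Data.List.Relation.Unary.All.Properties as All
open import Data.List.Relation.Unary.AllPairs as AllPairs using (AllPairs; []; _∷_)
import Data.List.Relation.Unary.AllPairs.Properties as AllPairs
open import Data.List.Relation.Unary.Any using (Any; here; there)
open import Data.Nat using (ℕ; zero; suc; _+_; _*_; _∸_; _^_; _≤_; _<_; z≤n; s≤s)
open import Data.Nat.DivMod using (_%_; _/_; m%n≤m; m/n≤m; m≡m%n+[m/n]*n; [m+n]%n≡m%n; m/n≡1+[m∸n]/n)
open import Data.Nat.Properties as ℕ using ()
open import Data.Nat.Tactic.RingSolver using (solve-∀)
open import Data.Product using (∃; ∃₂; _×_; _,_; proj₁; proj₂; map₁)
open import Data.Sum using (_⊎_; inj₁; inj₂)
open import Data.Unit using (⊤; tt)
open import Data.Vec using ([]; _∷_; here; there)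
open import Function using (_∘_; _∘′_; _∋_)
open import Relation.Binary using (tri<; tri≈; tri>)
open import Relation.Binary.PropositionalEquality
open import Relation.Nullary using (¬_)

radix : ℕ → ℕ → ℕ → ℕ
radix b h l = h * b + l

radix-<-high : ∀ {b h h′ l l′} → l < b → h < h′ → radix b h l < radix b h′ l′
radix-<-high {b} {h} {h′} {l} {l′} l<b h<h′ = begin-strict
  h * b + l  <⟨ ℕ.+-monoʳ-< (h * b) l<b ⟩
  h * b + b  ≡⟨ ℕ.+-comm (h * b) b ⟩
  suc h * b  ≤⟨ ℕ.*-monoˡ-≤ b h<h′ ⟩
  h′ * b     ≤⟨ ℕ.m≤m+n (h′ * b) l′ ⟩
  h′ * b + l′ ∎
  where open ℕ.≤-Reasoning

radix-<-low : ∀ {b h l l′} → l < l′ → radix b h l < radix b h l′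
radix-<-low {b} {h} = ℕ.+-monoʳ-< (h * b)

radix-high-≤ : ∀ {b h h′ l l′} → l′ < b → radix b h l ≤ radix b h′ l′ → h ≤ h′
radix-high-≤ l′<b le = ℕ.≮⇒≥ λ h′<h → ℕ.<⇒≱ (radix-<-high l′<b h′<h) le

radix-low-≤ : ∀ {b h l l′} → radix b h l ≤ radix b h l′ → l ≤ l′
radix-low-≤ {b} {h} = ℕ.+-cancelˡ-≤ (h * b) _ _

radix-injective : ∀ {b h h′ l l′} → l < b → l′ < b → radix b h l ≡ radix b h′ l′ → h ≡ h′ × l ≡ l′
radix-injective {b} {h} {h′} l<b l′<b eq
  with refl ← ℕ.≤-antisym (radix-high-≤ {h = h} {h′} l′<b (ℕ.≤-reflexive eq))
                         (radix-high-≤ {h = h′} {h} l<b (ℕ.≤-reflexive (sym eq)))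
  = refl , ℕ.+-cancelˡ-≡ (h * b) _ _ eq

opposite-reverses-≤ : ∀ {n} {i j : Fin n} → opposite i Fin.≤ opposite j → j Fin.≤ i
opposite-reverses-≤ {n} {i} {j} le = ℕ.≮⇒≥ λ i<j → ℕ.<⇒≱ (reverse i<j) le
  where
  reverse : toℕ i < toℕ j → toℕ (opposite j) < toℕ (opposite i)
  reverse i<j rewrite opposite-prop i | opposite-prop j = ℕ.∸-monoʳ-< (s≤s i<j) (toℕ<n j)

opposite-injective : ∀ {n} {i j : Fin n} → opposite i ≡ opposite j → i ≡ j
opposite-injective {i = i} {j} eq =
  trans (sym (Fin.opposite-involutive i)) (trans (cong opposite eq) (Fin.opposite-involutive j))

m∸n≡1+m∸[1+n] : ∀ {m n} → suc n ≤ m → m ∸ n ≡ suc (m ∸ suc n)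
m∸n≡1+m∸[1+n] = ℕ.+-∸-assoc 1

elements : ∀ {n} → Subset n → List (Fin n)
elements [] = []
elements (inside ∷ s) = zero ∷ map suc (elements s)
elements (outside ∷ s) = map suc (elements s)

length-elements : ∀ {n} (s : Subset n) → length (elements s) ≡ ∣ s ∣
length-elements [] = refl
length-elements (inside ∷ s) = cong suc (trans (length-map suc (elements s)) (length-elements s))
length-elements (outside ∷ s) = trans (length-map suc (elements s)) (length-elements s)

∈-elements⁺ : ∀ {n} {s : Subset n} {i} → i Subset.∈ s → i ∈ elements s
∈-elements⁺ {s = inside ∷ _} here = here refl
∈-elements⁺ {s = inside ∷ _} (there i∈s) = there (∈-map⁺ suc (∈-elements⁺ i∈s))
∈-elements⁺ {s = outside ∷ _} (there i∈s) = ∈-map⁺ suc (∈-elements⁺ i∈s)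

∈-elements⁻ : ∀ {n} {s : Subset n} {i} → i ∈ elements s → i Subset.∈ s
∈-elements⁻ {s = inside ∷ _} (here refl) = here
∈-elements⁻ {s = inside ∷ _} (there i∈) with ∈-map⁻ suc i∈
... | _ , j∈ , refl = there (∈-elements⁻ j∈)
∈-elements⁻ {s = outside ∷ _} i∈ with ∈-map⁻ suc i∈
... | _ , j∈ , refl = there (∈-elements⁻ j∈)

elements-increasing : ∀ {n} (s : Subset n) → AllPairs Fin._<_ (elements s)
elements-increasing [] = []
elements-increasing (inside ∷ s) =
  All.map⁺ (All.universal (λ _ → s≤s z≤n) (elements s))
  ∷ AllPairs.map⁺ (AllPairs.map s≤s (elements-increasing s))
elements-increasing (outside ∷ s) =
  AllPairs.map⁺ (AllPairs.map s≤s (elements-increasing s))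

OneOf : ∀ {n} → Fin n → Fin n → Fin n → Fin n → Set
OneOf a b c i = i ≡ a ⊎ i ≡ b ⊎ i ≡ c

Spans : ∀ {n} → Subset n → Fin n → Fin n → Fin n → Set
Spans s a b c = ∀ i → (i Subset.∈ s → OneOf a b c i) × (OneOf a b c i → i Subset.∈ s)

spans-swap : ∀ {n} {s : Subset n} {a b c} → Spans s a b c → Spans s b a c
spans-swap spans i with spans i
... | to , from = swap ∘ to , from ∘ swap
  where
  swap : ∀ {a b c} → OneOf a b c i → OneOf b a c i
  swap (inj₁ e) = inj₂ (inj₁ e)
  swap (inj₂ (inj₁ e)) = inj₁ e
  swap (inj₂ (inj₂ e)) = inj₂ (inj₂ e)

spans-rotate : ∀ {n} {s : Subset n} {a b c} → Spans s a b c → Spans s b c a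
spans-rotate spans i with spans i
... | to , from = rotate ∘ to , from ∘ unrotate
  where
  rotate : ∀ {a b c} → OneOf a b c i → OneOf b c a i
  rotate (inj₁ e) = inj₂ (inj₂ e)
  rotate (inj₂ (inj₁ e)) = inj₁ e
  rotate (inj₂ (inj₂ e)) = inj₂ (inj₁ e)
  unrotate : ∀ {a b c} → OneOf b c a i → OneOf a b c i
  unrotate (inj₂ (inj₂ e)) = inj₁ e
  unrotate (inj₁ e) = inj₂ (inj₁ e)
  unrotate (inj₂ (inj₁ e)) = inj₂ (inj₂ e)

record Triple {n} (s : Subset n) : Set where
  field
    x y z : Fin n
    x<y : x Fin.< y
    y<z : y Fin.< z
    spans : Spans s x y z

triple : ∀ {n} (s : Subset n) → ∣ s ∣ ≡ 3 → Triple s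
triple {n} s ∣s∣≡3 =
  fromList (elements s) (trans (length-elements s) ∣s∣≡3) (elements-increasing s)
    ∈-elements⁺ ∈-elements⁻
  where
  fromList : (xs : List (Fin n)) → length xs ≡ 3 → AllPairs Fin._<_ xs →
             (∀ {i} → i Subset.∈ s → i ∈ xs) → (∀ {i} → i ∈ xs → i Subset.∈ s) →
             Triple s
  fromList (x ∷ y ∷ z ∷ []) _ ((x<y ∷ _) ∷ (y<z ∷ []) ∷ _) to from = record
    { x = x ; y = y ; z = z ; x<y = x<y ; y<z = y<z
    ; spans = λ i → oneOf ∘ to , from ∘ member }
    where
    oneOf : ∀ {i} → i ∈ x ∷ y ∷ z ∷ [] → OneOf x y z i
    oneOf (here e) = inj₁ e
    oneOf (there (here e)) = inj₂ (inj₁ e)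
    oneOf (there (there (here e))) = inj₂ (inj₂ e)
    member : ∀ {i} → OneOf x y z i → i ∈ x ∷ y ∷ z ∷ []
    member (inj₁ e) = here e
    member (inj₂ (inj₁ e)) = there (here e)
    member (inj₂ (inj₂ e)) = there (there (here e))

<⇒∃-gap : ∀ {m n} → m < n → ∃ λ d → n ≡ m + suc d
<⇒∃-gap {m} m<n with d , eq ← ℕ.m≤n⇒∃[o]m+o≡n m<n = d , trans (sym eq) (sym (ℕ.+-suc m d))

record ClosePair {n} (s : Subset n) : Set where
  field
    p q r : Fin n
    gap : ℕ
    q≡p+gap : toℕ q ≡ toℕ p + suc gap
    gap-small : suc gap + suc gap ≤ n
    r≢p : r ≢ p
    r≢q : r ≢ q
    spans : Spans s p q r

closePair : ∀ {n} {s : Subset n} → Triple s → ClosePair s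
closePair {n} {s} t = choose (<⇒∃-gap x<y) (<⇒∃-gap y<z)
  where
  open Triple t
  gaps-small : ∀ {d₁ d₂} → toℕ y ≡ toℕ x + suc d₁ → toℕ z ≡ toℕ y + suc d₂ →
               suc d₁ + suc d₂ ≤ n
  gaps-small {d₁} {d₂} y≡ z≡ = begin
    suc d₁ + suc d₂              ≤⟨ ℕ.m≤n+m _ (toℕ x) ⟩
    toℕ x + (suc d₁ + suc d₂)    ≡⟨ sym (ℕ.+-assoc (toℕ x) _ _) ⟩
    toℕ x + suc d₁ + suc d₂      ≡⟨ cong (_+ suc d₂) (sym y≡) ⟩
    toℕ y + suc d₂               ≡⟨ sym z≡ ⟩
    toℕ z                        <⟨ toℕ<n z ⟩
    n                            ∎
    where open ℕ.≤-Reasoning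
  choose : (∃ λ d → toℕ y ≡ toℕ x + suc d) → (∃ λ d → toℕ z ≡ toℕ y + suc d) → ClosePair s
  choose (d₁ , y≡) (d₂ , z≡) with ℕ.≤-total d₁ d₂
  ... | inj₁ d₁≤d₂ = record
    { p = x ; q = y ; r = z ; gap = d₁ ; q≡p+gap = y≡
    ; gap-small = ℕ.≤-trans (ℕ.+-monoʳ-≤ (suc d₁) (s≤s d₁≤d₂)) (gaps-small y≡ z≡)
    ; r≢p = λ { refl → ℕ.<-asym x<y y<z } ; r≢q = λ { refl → ℕ.<-irrefl refl y<z }
    ; spans = spans }
  ... | inj₂ d₂≤d₁ = record
    { p = y ; q = z ; r = x ; gap = d₂ ; q≡p+gap = z≡
    ; gap-small = ℕ.≤-trans (ℕ.+-monoˡ-≤ (suc d₂) (s≤s d₂≤d₁)) (gaps-small y≡ z≡)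
    ; r≢p = λ { refl → ℕ.<-irrefl refl x<y } ; r≢q = λ { refl → ℕ.<-asym x<y y<z }
    ; spans = spans-rotate spans }

sideCode : Subset.Side → Fin 2
sideCode inside = zero
sideCode outside = suc zero

sideCode-injective : ∀ {a b} → sideCode a ≡ sideCode b → a ≡ b
sideCode-injective {inside} {inside} _ = refl
sideCode-injective {outside} {outside} _ = refl

subsetCode : ∀ {n} → Subset n → Fin (2 ^ n)
subsetCode [] = zero
subsetCode (side ∷ s) = combine (sideCode side) (subsetCode s)

subsetCode-injective : ∀ {n} {s s′ : Subset n} → subsetCode s ≡ subsetCode s′ → s ≡ s′
subsetCode-injective {s = []} {[]} _ = refl
subsetCode-injective {s = side ∷ s} {side′ ∷ s′} eq
  with sides≡ , codes≡ ← Fin.combine-injective (sideCode side) (subsetCode s)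
                                               (sideCode side′) (subsetCode s′) eq
  = cong₂ _∷_ (sideCode-injective sides≡) (subsetCode-injective codes≡)

data Direction : Set where
  rightward upward : Direction

turn : Direction → Direction
turn rightward = upward
turn upward = rightward

Staircase : Direction → List Point → Set
Staircase d [] = ⊤
Staircase d (p ∷ []) = ⊤
Staircase rightward (p ∷ q ∷ r) = (Y p ≡ Y q × X p ℤ.< X q) × Staircase upward (q ∷ r)
Staircase upward (p ∷ q ∷ r) = (X p ≡ X q × Y p ℤ.< Y q) × Staircase rightward (q ∷ r)

infix 4 _≼_
_≼_ : Point → Point → Set
p ≼ q = X p ℤ.≤ X q × Y p ℤ.≤ Y q

≼-trans : ∀ {p q r} → p ≼ q → q ≼ r → p ≼ r
≼-trans (x≤ , y≤) (x≤′ , y≤′) = ℤ.≤-trans x≤ x≤′ , ℤ.≤-trans y≤ y≤′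

≼-antisym : ∀ {p q} → p ≼ q → q ≼ p → p ≡ q
≼-antisym (x≤ , y≤) (x≥ , y≥) = cong₂ _,_ (ℤ.≤-antisym x≤ x≥) (ℤ.≤-antisym y≤ y≥)

staircase-tail : ∀ {d p q r} → Staircase d (p ∷ q ∷ r) → Staircase (turn d) (q ∷ r)
staircase-tail {rightward} (_ , s) = s
staircase-tail {upward} (_ , s) = s

staircase-step : ∀ {d p q r} → Staircase d (p ∷ q ∷ r) → p ≼ q × ¬ q ≼ p
staircase-step {rightward} ((y≡ , x<) , _) = (ℤ.<⇒≤ x< , ℤ.≤-reflexive y≡) , ℤ.<⇒≱ x< ∘ proj₁
staircase-step {upward} ((x≡ , y<) , _) = (ℤ.≤-reflexive x≡ , ℤ.<⇒≤ y<) , ℤ.<⇒≱ y< ∘ proj₂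

between-ordered : ∀ {a b c} → a ℤ.≤ b → Between a b c → a ℤ.≤ c × c ℤ.≤ b
between-ordered a≤b (inj₁ a≤c≤b) = a≤c≤b
between-ordered a≤b (inj₂ (b≤c , c≤a)) = ℤ.≤-trans a≤b b≤c , ℤ.≤-trans c≤a a≤b

onSeg-≼ : ∀ {a b x} → a ≼ b → OnSeg x (a , b) → a ≼ x × x ≼ b
onSeg-≼ (ax≤bx , _) (inj₁ (y≡ , y≡′ , between))
  with a≤ , ≤b ← between-ordered ax≤bx between
  = (a≤ , ℤ.≤-reflexive (sym y≡)) , (≤b , ℤ.≤-reflexive (trans y≡ y≡′))
onSeg-≼ (_ , ay≤by) (inj₂ (x≡ , x≡′ , between))
  with a≤ , ≤b ← between-ordered ay≤by between
  = (ℤ.≤-reflexive (sym x≡) , a≤) , (ℤ.≤-reflexive (trans x≡ x≡′) , ≤b)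

staircase-above-start : ∀ {d p ps s x} → Staircase d (p ∷ ps) → s ∈ segs (p ∷ ps) →
                        OnSeg x s → p ≼ x
staircase-above-start {ps = _ ∷ _} stair (here refl) x∈s =
  proj₁ (onSeg-≼ (proj₁ (staircase-step stair)) x∈s)
staircase-above-start {ps = _ ∷ _ ∷ _} stair (there s∈) x∈s =
  ≼-trans (proj₁ (staircase-step stair)) (staircase-above-start (staircase-tail stair) s∈ x∈s)

simple-∷ : ∀ {s ss} → Simple ss →
           (∀ {x} k → OnSeg x s → OnSeg x (lookup ss k) → toℕ k ≡ 0 × x ≡ proj₂ s) →
           Simple (s ∷ ss)
simple-∷ simple head zero (suc j) x _ x∈s x∈t with head j x∈s x∈t
... | j≡0 , x≡ = cong suc j≡0 , x≡
simple-∷ simple head (suc i) (suc j) x (s≤s i<j) x∈s x∈t with simple i j x i<j x∈s x∈t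
... | j≡ , x≡ = cong suc j≡ , x≡

-- A point of a staircase segment lies between its ends in the order ≼, along
-- which the corners strictly increase.
staircase-simple : ∀ {d} ps → Staircase d ps → Simple (segs ps)
staircase-simple (p ∷ q ∷ []) stair zero zero _ ()
staircase-simple (p ∷ q ∷ r ∷ rs) stair =
  simple-∷ (staircase-simple (q ∷ r ∷ rs) (staircase-tail stair)) meets-head
  where
  p≼q = proj₁ (staircase-step stair)
  next = staircase-tail stair
  meets-head : ∀ {x} k → OnSeg x (p , q) → OnSeg x (lookup (segs (q ∷ r ∷ rs)) k) →
               toℕ k ≡ 0 × x ≡ q
  meets-head zero x∈pq x∈qr =
    refl , ≼-antisym (proj₂ (onSeg-≼ p≼q x∈pq)) (proj₁ (onSeg-≼ (proj₁ (staircase-step next)) x∈qr))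
  meets-head (suc k) x∈pq x∈later = ⊥-elim (proj₂ (staircase-step next)
    (≼-trans (staircase-above-start (staircase-tail next) (∈-lookup k) x∈later)
             (proj₂ (onSeg-≼ p≼q x∈pq))))

staircase-axisParallel : ∀ {d} ps → Staircase d ps → All (λ s → Horizontal s ⊎ Vertical s) (segs ps)
staircase-axisParallel [] _ = []
staircase-axisParallel (p ∷ []) _ = []
staircase-axisParallel {rightward} (p ∷ q ∷ r) ((y≡ , x<) , stair) =
  inj₁ (y≡ , ℤ.<⇒≢ x<) ∷ staircase-axisParallel (q ∷ r) stair
staircase-axisParallel {upward} (p ∷ q ∷ r) ((x≡ , y<) , stair) =
  inj₂ (x≡ , ℤ.<⇒≢ y<) ∷ staircase-axisParallel (q ∷ r) stair

staircase-alternating : ∀ {d} ps → Staircase d ps → Alternating (segs ps)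
staircase-alternating [] _ = tt
staircase-alternating (p ∷ []) _ = tt
staircase-alternating (p ∷ q ∷ []) _ = tt
staircase-alternating {rightward} (p ∷ q ∷ r ∷ rs) ((y≡ , x<) , stair@((x≡ , y<) , _)) =
  inj₁ ((y≡ , ℤ.<⇒≢ x<) , (x≡ , ℤ.<⇒≢ y<)) , staircase-alternating {upward} (q ∷ r ∷ rs) stair
staircase-alternating {upward} (p ∷ q ∷ r ∷ rs) ((x≡ , y<) , stair@((y≡ , x<) , _)) =
  inj₂ ((x≡ , ℤ.<⇒≢ y<) , (y≡ , ℤ.<⇒≢ x<)) , staircase-alternating {rightward} (q ∷ r ∷ rs) stair

staircasePath : ∀ {d} (ps : List Point) → 2 ≤ length ps → Staircase d ps → GridPath
staircasePath ps 2≤len stair = record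
  { pts = ps ; nonTrivial = 2≤len ; axisParallel = staircase-axisParallel ps stair
  ; alternating = staircase-alternating ps stair ; simple = staircase-simple ps stair }

cornerXs cornerYs : GridPath → List ℤ
cornerXs P = map X (pts P)
cornerYs P = map Y (pts P)

DisjointCorners : GridPath → GridPath → Set
DisjointCorners P Q = (∀ {x} → x ∈ cornerXs P → x ∉ cornerXs Q) × (∀ {y} → y ∈ cornerYs P → y ∉ cornerYs Q)

disjointCorners-sym : ∀ {P Q} → DisjointCorners P Q → DisjointCorners Q P
disjointCorners-sym (xs# , ys#) = (λ x∈Q x∈P → xs# x∈P x∈Q) , (λ y∈Q y∈P → ys# y∈P y∈Q)

segment-ends : ∀ {s} ps → s ∈ segs ps → proj₁ s ∈ ps × proj₂ s ∈ ps
segment-ends (p ∷ q ∷ r) (here refl) = here refl , there (here refl)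
segment-ends (p ∷ q ∷ r) (there s∈) with segment-ends (q ∷ r) s∈
... | a∈ , b∈ = there a∈ , there b∈

on-horizontal : ∀ {a b p} → Horizontal (a , b) → OnSeg p (a , b) →
                Y p ≡ Y a × Between (X a) (X b) (X p)
on-horizontal _ (inj₁ (y≡ , _ , between)) = y≡ , between
on-horizontal (_ , x≢) (inj₂ (_ , x≡ , _)) = ⊥-elim (x≢ x≡)

on-vertical : ∀ {a b p} → Vertical (a , b) → OnSeg p (a , b) →
              X p ≡ X a × Between (Y a) (Y b) (Y p)
on-vertical _ (inj₂ (x≡ , _ , between)) = x≡ , between
on-vertical (_ , y≢) (inj₁ (_ , y≡ , _)) = ⊥-elim (y≢ y≡)

strictly-between : ∀ {a b c} → Between a b c → c ≢ a → c ≢ b → StrictlyBetween a b c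
strictly-between (inj₁ (a≤c , c≤b)) c≢a c≢b =
  inj₁ (ℤ.≤∧≢⇒< a≤c (c≢a ∘ sym) , ℤ.≤∧≢⇒< c≤b c≢b)
strictly-between (inj₂ (b≤c , c≤a)) c≢a c≢b =
  inj₂ (ℤ.≤∧≢⇒< b≤c (c≢b ∘ sym) , ℤ.≤∧≢⇒< c≤a c≢a)

record SegmentThrough (P : GridPath) (p : Point) : Set where
  field
    seg : Segment
    seg∈ : seg ∈ segs (pts P)
    p∈seg : OnSeg p seg

  orientation : Horizontal seg ⊎ Vertical seg
  orientation = All.lookup (axisParallel P) seg∈

  height-corner : Horizontal seg → Y p ∈ cornerYs P
  height-corner h = subst (_∈ cornerYs P) (sym (proj₁ (on-horizontal h p∈seg)))
                          (∈-map⁺ Y (proj₁ (segment-ends (pts P) seg∈)))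

  abscissa-corner : Vertical seg → X p ∈ cornerXs P
  abscissa-corner v = subst (_∈ cornerXs P) (sym (proj₁ (on-vertical v p∈seg)))
                            (∈-map⁺ X (proj₁ (segment-ends (pts P) seg∈)))

  horizontal-interior : Horizontal seg → X p ∉ cornerXs P → InSegInterior p seg
  horizontal-interior h x∉ with y≡ , between ← on-horizontal h p∈seg =
    inj₁ (y≡ , proj₁ h , strictly-between between
      (λ x≡ → x∉ (subst (_∈ cornerXs P) (sym x≡) (∈-map⁺ X (proj₁ ends))))
      (λ x≡ → x∉ (subst (_∈ cornerXs P) (sym x≡) (∈-map⁺ X (proj₂ ends)))))
    where ends = segment-ends (pts P) seg∈

  vertical-interior : Vertical seg → Y p ∉ cornerYs P → InSegInterior p seg
  vertical-interior v y∉ with x≡ , between ← on-vertical v p∈seg =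
    inj₂ (x≡ , proj₁ v , strictly-between between
      (λ y≡ → y∉ (subst (_∈ cornerYs P) (sym y≡) (∈-map⁺ Y (proj₁ ends))))
      (λ y≡ → y∉ (subst (_∈ cornerYs P) (sym y≡) (∈-map⁺ Y (proj₂ ends)))))
    where ends = segment-ends (pts P) seg∈

segmentThrough : ∀ {P p} → OnPath p P → SegmentThrough P p
segmentThrough p∈P with s , s∈ , p∈s ← find p∈P = record { seg = s ; seg∈ = s∈ ; p∈seg = p∈s }

intersect-sym : ∀ {P Q} → Intersect P Q → Intersect Q P
intersect-sym (p , p∈P , p∈Q) = p , p∈Q , p∈P

not-horizontal-and-vertical : ∀ {s} → Horizontal s → Vertical s → ⊥
not-horizontal-and-vertical (y≡ , _) (_ , y≢) = y≢ y≡

module _ {P Q : GridPath} {p : Point} (disjoint : DisjointCorners P Q)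
         (S : SegmentThrough P p) (T : SegmentThrough Q p) where
  open SegmentThrough

  -- Two horizontal segments through p would give both paths a corner at height Y p.
  transversal : (Horizontal (seg S) × Vertical (seg T)) ⊎ (Vertical (seg S) × Horizontal (seg T))
  transversal with orientation S | orientation T
  ... | inj₁ h | inj₁ h′ = ⊥-elim (proj₂ disjoint (height-corner S h) (height-corner T h′))
  ... | inj₂ v | inj₂ v′ = ⊥-elim (proj₁ disjoint (abscissa-corner S v) (abscissa-corner T v′))
  ... | inj₁ h | inj₂ v = inj₁ (h , v)
  ... | inj₂ v | inj₁ h = inj₂ (v , h)

  crossesAt : CrossAt p P Q
  crossesAt with transversal
  ... | inj₁ (h , v) = lose (seg∈ S) (lose (seg∈ T)
          ( horizontal-interior S h (λ x∈P → proj₁ disjoint x∈P (abscissa-corner T v))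
          , vertical-interior T v (proj₂ disjoint (height-corner S h))
          , inj₁ (h , v)))
  ... | inj₂ (v , h) = lose (seg∈ S) (lose (seg∈ T)
          ( vertical-interior S v (λ y∈P → proj₂ disjoint y∈P (height-corner T h))
          , horizontal-interior T h (proj₁ disjoint (abscissa-corner S v))
          , inj₂ (v , h)))

  on-corner-grid : p ∈ cartesianProduct (cornerXs P ++ cornerXs Q) (cornerYs P ++ cornerYs Q)
  on-corner-grid with transversal
  ... | inj₁ (h , v) =
    ∈-cartesianProduct⁺ (∈-++⁺ʳ (cornerXs P) (abscissa-corner T v)) (∈-++⁺ˡ (height-corner S h))
  ... | inj₂ (v , h) =
    ∈-cartesianProduct⁺ (∈-++⁺ˡ (abscissa-corner S v)) (∈-++⁺ʳ (cornerYs P) (height-corner T h))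

disjointCorners-crossing : ∀ {P Q p} → DisjointCorners P Q → OnPath p P → OnPath p Q → CrossAt p P Q
disjointCorners-crossing {P} {Q} disjoint p∈P p∈Q =
  crossesAt disjoint (segmentThrough {P} p∈P) (segmentThrough {Q} p∈Q)

disjointCorners-finite : ∀ {P Q p} → DisjointCorners P Q → OnPath p P → OnPath p Q →
  p ∈ cartesianProduct (cornerXs P ++ cornerXs Q) (cornerYs P ++ cornerYs Q)
disjointCorners-finite {P} {Q} disjoint p∈P p∈Q =
  on-corner-grid disjoint (segmentThrough {P} p∈P) (segmentThrough {Q} p∈Q)

disjointCorners-no-triple : ∀ {P Q R p} →
  DisjointCorners P Q → DisjointCorners P R → DisjointCorners Q R →
  OnPath p P → OnPath p Q → ¬ OnPath p R
disjointCorners-no-triple {P} {Q} {R} {p} PQ PR QR p∈P p∈Q p∈R =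
  pigeonhole (segmentThrough {P} p∈P) (segmentThrough {Q} p∈Q) (segmentThrough {R} p∈R)
  where
  pigeonhole : SegmentThrough P p → SegmentThrough Q p → SegmentThrough R p → ⊥
  pigeonhole S T U with transversal PQ S T | transversal PR S U | transversal QR T U
  ... | inj₁ (_ , vT) | inj₁ _ | inj₁ (hT , _) = not-horizontal-and-vertical hT vT
  ... | inj₁ _ | inj₁ (_ , vU) | inj₂ (_ , hU) = not-horizontal-and-vertical hU vU
  ... | inj₂ _ | inj₂ (_ , hU) | inj₁ (_ , vU) = not-horizontal-and-vertical hU vU
  ... | inj₂ (_ , hT) | inj₂ _ | inj₂ (vT , _) = not-horizontal-and-vertical hT vT
  ... | inj₁ (hS , _) | inj₂ (vS , _) | _ = not-horizontal-and-vertical hS vS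
  ... | inj₂ (vS , _) | inj₁ (hS , _) | _ = not-horizontal-and-vertical hS vS

pt : ℕ → ℕ → Point
pt x y = + x , + y

hseg : ℕ → ℕ → ℕ → Segment
hseg y x₁ x₂ = pt x₁ y , pt x₂ y

vseg : ℕ → ℕ → ℕ → Segment
vseg x y₁ y₂ = pt x y₁ , pt x y₂

on-hseg : ∀ {x₁ x x₂ y} → x₁ ≤ x → x ≤ x₂ → OnSeg (pt x y) (hseg y x₁ x₂)
on-hseg x₁≤x x≤x₂ = inj₁ (refl , refl , inj₁ (+≤+ x₁≤x , +≤+ x≤x₂))

on-vseg : ∀ {y₁ y y₂ x} → y₁ ≤ y → y ≤ y₂ → OnSeg (pt x y) (vseg x y₁ y₂)
on-vseg y₁≤y y≤y₂ = inj₂ (refl , refl , inj₁ (+≤+ y₁≤y , +≤+ y≤y₂))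

hseg-bounds : ∀ {p y x₁ x₂} → x₁ < x₂ → OnSeg p (hseg y x₁ x₂) →
              Y p ≡ + y × + x₁ ℤ.≤ X p × X p ℤ.≤ + x₂
hseg-bounds x₁<x₂ p∈ with y≡ , between ← on-horizontal (refl , ℤ.<⇒≢ (ℤ.+<+ x₁<x₂)) p∈ =
  y≡ , between-ordered (+≤+ (ℕ.<⇒≤ x₁<x₂)) between

vseg-bounds : ∀ {p x y₁ y₂} → y₁ < y₂ → OnSeg p (vseg x y₁ y₂) →
              X p ≡ + x × + y₁ ℤ.≤ Y p × Y p ℤ.≤ + y₂
vseg-bounds y₁<y₂ p∈ with x≡ , between ← on-vertical (refl , ℤ.<⇒≢ (ℤ.+<+ y₁<y₂)) p∈ =
  x≡ , between-ordered (+≤+ (ℕ.<⇒≤ y₁<y₂)) between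

hseg-vseg-meet : ∀ {p y x₁ x₂ x y₁ y₂} → x₁ < x₂ → y₁ < y₂ →
  OnSeg p (hseg y x₁ x₂) → OnSeg p (vseg x y₁ y₂) → (x₁ ≤ x × x ≤ x₂) × (y₁ ≤ y × y ≤ y₂)
hseg-vseg-meet x₁<x₂ y₁<y₂ p∈h p∈v
  with y≡ , x₁≤ , ≤x₂ ← hseg-bounds x₁<x₂ p∈h | x≡ , y₁≤ , ≤y₂ ← vseg-bounds y₁<y₂ p∈v
  rewrite y≡ | x≡ = (ℤ.drop‿+≤+ x₁≤ , ℤ.drop‿+≤+ ≤x₂) , (ℤ.drop‿+≤+ y₁≤ , ℤ.drop‿+≤+ ≤y₂)

hseg-hseg-meet : ∀ {p y x₁ x₂ y′ x₁′ x₂′} → x₁ < x₂ → x₁′ < x₂′ →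
  OnSeg p (hseg y x₁ x₂) → OnSeg p (hseg y′ x₁′ x₂′) → y ≡ y′
hseg-hseg-meet x₁<x₂ x₁′<x₂′ p∈ p∈′ =
  ℤ.+-injective (trans (sym (proj₁ (hseg-bounds x₁<x₂ p∈))) (proj₁ (hseg-bounds x₁′<x₂′ p∈′)))

vseg-vseg-meet : ∀ {p x y₁ y₂ x′ y₁′ y₂′} → y₁ < y₂ → y₁′ < y₂′ →
  OnSeg p (vseg x y₁ y₂) → OnSeg p (vseg x′ y₁′ y₂′) → x ≡ x′
vseg-vseg-meet y₁<y₂ y₁′<y₂′ p∈ p∈′ =
  ℤ.+-injective (trans (sym (proj₁ (vseg-bounds y₁<y₂ p∈))) (proj₁ (vseg-bounds y₁′<y₂′ p∈′)))

module Stairs (g : ℕ → ℕ) where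

  row column : ℕ → Segment
  row e = hseg (g (suc e)) (g e) (g (suc e))
  column e = vseg (g (suc e)) (g (suc e)) (g (suc (suc e)))

  stairs : ℕ → ℕ → List Point
  stairs e zero = pt (g e) (g (suc e)) ∷ []
  stairs e (suc k) = pt (g e) (g (suc e)) ∷ pt (g (suc e)) (g (suc e)) ∷ stairs (suc e) k

  segs-cons-stairs : ∀ q e k → segs (q ∷ stairs e k) ≡ (q , pt (g e) (g (suc e))) ∷ segs (stairs e k)
  segs-cons-stairs q e zero = refl
  segs-cons-stairs q e (suc k) = refl

  length-segs-stairs : ∀ e k → length (segs (stairs e k)) ≡ k + k
  length-segs-stairs e zero = refl
  length-segs-stairs e (suc k) = begin
    length (segs (stairs e (suc k)))                       ≡⟨ cong (suc ∘′ length) (segs-cons-stairs _ (suc e) k) ⟩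
    suc (suc (length (segs (stairs (suc e) k))))            ≡⟨ cong (suc ∘′ suc) (length-segs-stairs (suc e) k) ⟩
    suc (suc (k + k))                                      ≡⟨ cong suc (sym (ℕ.+-suc k k)) ⟩
    suc k + suc k                                          ∎
    where open ≡-Reasoning

  module _ (g-< : ∀ e → g e < g (suc e)) where

    stairs-staircase : ∀ e k → Staircase rightward (stairs e k)
    stairs-staircase e zero = tt
    stairs-staircase e (suc zero) = (refl , ℤ.+<+ (g-< e)) , (refl , ℤ.+<+ (g-< (suc e))) , tt
    stairs-staircase e (suc (suc k)) =
      (refl , ℤ.+<+ (g-< e)) , (refl , ℤ.+<+ (g-< (suc e))) , stairs-staircase (suc e) (suc k)

  on-stairs : ∀ {p} e k → Any (OnSeg p) (segs (stairs e k)) →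
              ∃ λ e′ → OnSeg p (row e′) ⊎ OnSeg p (column e′)
  on-stairs e (suc k) (here p∈) = e , inj₁ p∈
  on-stairs e (suc k) (there p∈) rewrite segs-cons-stairs (pt (g (suc e)) (g (suc e))) (suc e) k
    with p∈
  ... | here p∈′ = e , inj₂ p∈′
  ... | there p∈′ = on-stairs (suc e) k p∈′

  row-∈-stairs : ∀ {e₀ e} k → e₀ ≤ e → e < e₀ + k → row e ∈ segs (stairs e₀ k)
  row-∈-stairs zero e₀≤e e<e₀ = ⊥-elim (ℕ.<⇒≱ (subst (_ <_) (ℕ.+-identityʳ _) e<e₀) e₀≤e)
  row-∈-stairs {e₀} {e} (suc k) e₀≤e e<e₀+k with ℕ.m≤n⇒m<n∨m≡n e₀≤e
  ... | inj₂ refl = here refl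
  ... | inj₁ e₀<e rewrite segs-cons-stairs (pt (g (suc e₀)) (g (suc e₀))) (suc e₀) k =
    there (there (row-∈-stairs k e₀<e (subst (e <_) (ℕ.+-suc e₀ k) e<e₀+k)))

  column-∈-stairs : ∀ {e₀ e} k → e₀ ≤ e → e < e₀ + k → column e ∈ segs (stairs e₀ k)
  column-∈-stairs zero e₀≤e e<e₀ = ⊥-elim (ℕ.<⇒≱ (subst (_ <_) (ℕ.+-identityʳ _) e<e₀) e₀≤e)
  column-∈-stairs {e₀} {e} (suc k) e₀≤e e<e₀+k with ℕ.m≤n⇒m<n∨m≡n e₀≤e
  ... | inj₂ refl rewrite segs-cons-stairs (pt (g (suc e₀)) (g (suc e₀))) (suc e₀) k = there (here refl)
  ... | inj₁ e₀<e rewrite segs-cons-stairs (pt (g (suc e₀)) (g (suc e₀))) (suc e₀) k =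
    there (there (column-∈-stairs k e₀<e (subst (e <_) (ℕ.+-suc e₀ k) e<e₀+k)))

  stairs-corners : ∀ {q} e k → q ∈ stairs e k → (∃ λ e′ → X q ≡ + g e′) × (∃ λ e′ → Y q ≡ + g e′)
  stairs-corners e zero (here refl) = (e , refl) , (suc e , refl)
  stairs-corners e (suc k) (here refl) = (e , refl) , (suc e , refl)
  stairs-corners e (suc k) (there (here refl)) = (suc e , refl) , (suc e , refl)
  stairs-corners e (suc k) (there (there q∈)) = stairs-corners (suc e) k q∈

module _ {T : ℕ} where

  abstract

    coord : ℕ → Fin 5 → Fin T → ℕ
    coord s o t = radix T (radix 5 s (toℕ o)) (toℕ t)

    coord-<-slot : ∀ {s s′ o o′} {t t′ : Fin T} → s < s′ → coord s o t < coord s′ o′ t′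
    coord-<-slot {s} {s′} {o} {o′} {t} {t′} s<s′ =
      radix-<-high {h = radix 5 s (toℕ o)} {l′ = toℕ t′} (toℕ<n t)
                   (radix-<-high {l′ = toℕ o′} (toℕ<n o) s<s′)

    coord-<-offset : ∀ {s o o′} {t t′ : Fin T} → o Fin.< o′ → coord s o t < coord s o′ t′
    coord-<-offset {s} {o} {o′} {t} {t′} o<o′ =
      radix-<-high {h = radix 5 s (toℕ o)} {l′ = toℕ t′} (toℕ<n t) (radix-<-low {h = s} o<o′)

    coord-slot-≤ : ∀ {s s′ o o′} {t t′ : Fin T} → coord s o t ≤ coord s′ o′ t′ → s ≤ s′
    coord-slot-≤ {s} {s′} {o} {o′} {t} {t′} le =
      radix-high-≤ {l = toℕ o} (toℕ<n o′)
                   (radix-high-≤ {h = radix 5 s (toℕ o)} {l = toℕ t} (toℕ<n t′) le)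

    coord-offset-≤ : ∀ {s o o′} {t t′ : Fin T} → coord s o t ≤ coord s o′ t′ → o Fin.≤ o′
    coord-offset-≤ {s} {o} {o′} {t} {t′} le =
      radix-low-≤ {h = s} (radix-high-≤ {h = radix 5 s (toℕ o)} {l = toℕ t} (toℕ<n t′) le)

    coord-tag-≤ : ∀ {s o} {t t′ : Fin T} → coord s o t ≤ coord s o t′ → t Fin.≤ t′
    coord-tag-≤ {s} {o} = radix-low-≤ {h = radix 5 s (toℕ o)}

    coord-injective : ∀ {s s′ o o′} {t t′ : Fin T} →
                      coord s o t ≡ coord s′ o′ t′ → s ≡ s′ × o ≡ o′ × t ≡ t′
    coord-injective {s} {s′} {o} {o′} {t} {t′} eq
      with codes≡ , tags≡ ← radix-injective {h = radix 5 s (toℕ o)} (toℕ<n t) (toℕ<n t′) eq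
      with slots≡ , offsets≡ ← radix-injective {h = s} (toℕ<n o) (toℕ<n o′) codes≡
      = slots≡ , toℕ-injective offsets≡ , toℕ-injective tags≡

  private variable
    s s′ : ℕ
    o o′ o″ : Fin 5
    t t′ t″ : Fin T

  coord-offset-injective : coord s o t ≡ coord s′ o′ t′ → o ≡ o′
  coord-offset-injective eq = proj₁ (proj₂ (coord-injective eq))

  coord-tag-injective : coord s o t ≡ coord s′ o′ t′ → t ≡ t′
  coord-tag-injective eq = proj₂ (proj₂ (coord-injective eq))

  coord-squeeze : coord s o t ≤ coord s′ o′ t′ → coord s′ o′ t′ ≤ coord s o″ t″ → s′ ≡ s
  coord-squeeze below above = ℕ.≤-antisym (coord-slot-≤ above) (coord-slot-≤ below)

  coord-squeeze-suc : o′ Fin.< o →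
    coord s o t ≤ coord s′ o′ t′ → coord s′ o′ t′ ≤ coord (suc s) o″ t″ → s′ ≡ suc s
  coord-squeeze-suc o′<o below above with ℕ.m≤n⇒m<n∨m≡n (coord-slot-≤ below)
  ... | inj₁ s<s′ = ℕ.≤-antisym (coord-slot-≤ above) s<s′
  ... | inj₂ refl = ⊥-elim (ℕ.<⇒≱ o′<o (coord-offset-≤ below))

  coord-squeeze-low : o″ Fin.< o′ →
    coord s o t ≤ coord s′ o′ t′ → coord s′ o′ t′ ≤ coord (suc s) o″ t″ → s′ ≡ s
  coord-squeeze-low o″<o′ below above with ℕ.m≤n⇒m<n∨m≡n (coord-slot-≤ above)
  ... | inj₁ s′<1+s = ℕ.≤-antisym (ℕ.≤-pred s′<1+s) (coord-slot-≤ below)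
  ... | inj₂ refl = ⊥-elim (ℕ.<⇒≱ o″<o′ (coord-offset-≤ above))

module Ranks (n : ℕ) where

  maxRank : ℕ
  maxRank = radix (suc n) n n

  interleave : ℕ → ℕ → ℕ
  interleave m i = radix (suc n) (i % suc m) (i / suc m)

  interleave-≤ : ∀ m {i} → i < n → interleave m i ≤ maxRank
  interleave-≤ m {i} i<n = ℕ.+-mono-≤ (ℕ.*-monoˡ-≤ (suc n) (ℕ.≤-trans (m%n≤m i (suc m)) (ℕ.<⇒≤ i<n)))
                                      (ℕ.≤-trans (m/n≤m i (suc m)) (ℕ.<⇒≤ i<n))

  interleave-injective : ∀ m {i j} → i < n → j < n → interleave m i ≡ interleave m j → i ≡ j
  interleave-injective m {i} {j} i<n j<n eq
    with rem≡ , quot≡ ← radix-injective {h = i % suc m} (s≤s (ℕ.≤-trans (m/n≤m i (suc m)) (ℕ.<⇒≤ i<n)))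
                                                         (s≤s (ℕ.≤-trans (m/n≤m j (suc m)) (ℕ.<⇒≤ j<n))) eq
    = begin
      i                               ≡⟨ m≡m%n+[m/n]*n i (suc m) ⟩
      i % suc m + (i / suc m) * suc m ≡⟨ cong₂ (λ r q → r + q * suc m) rem≡ quot≡ ⟩
      j % suc m + (j / suc m) * suc m ≡⟨ sym (m≡m%n+[m/n]*n j (suc m)) ⟩
      j                               ∎
    where open ≡-Reasoning

  interleave-+gap : ∀ m i → interleave m (i + suc m) ≡ suc (interleave m i)
  interleave-+gap m i = begin
    radix (suc n) ((i + suc m) % suc m) ((i + suc m) / suc m)
      ≡⟨ cong₂ (radix (suc n)) ([m+n]%n≡m%n i (suc m)) quotient-+gap ⟩
    radix (suc n) (i % suc m) (suc (i / suc m))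
      ≡⟨ ℕ.+-suc ((i % suc m) * suc n) (i / suc m) ⟩
    suc (interleave m i) ∎
    where
    open ≡-Reasoning
    quotient-+gap : (i + suc m) / suc m ≡ suc (i / suc m)
    quotient-+gap = trans (m/n≡1+[m∸n]/n (ℕ.m≤n+m (suc m) i))
                          (cong (λ k → suc (k / suc m)) (ℕ.m+n∸n≡m i (suc m)))

  -- Level 2m+1 orders the clique by interleave m, level 2m+2 by the reverse
  -- order; level 0 is arbitrary.
  schedule : ℕ → ℕ × Bool
  schedule 0 = 0 , false
  schedule 1 = 0 , false
  schedule 2 = 0 , true
  schedule (suc (suc (suc E))) = map₁ suc (schedule (suc E))

  schedule-odd : ∀ m → schedule (suc (m + m)) ≡ (m , false)
  schedule-odd zero = refl
  schedule-odd (suc m) rewrite ℕ.+-suc m m | schedule-odd m = refl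

  schedule-even : ∀ m → schedule (suc (suc (m + m))) ≡ (m , true)
  schedule-even zero = refl
  schedule-even (suc m) rewrite ℕ.+-suc m m | schedule-even m = refl

  orient : Bool → ℕ → ℕ
  orient false k = k
  orient true k = maxRank ∸ k

  orient-≤ : ∀ b {k} → k ≤ maxRank → orient b k ≤ maxRank
  orient-≤ false k≤max = k≤max
  orient-≤ true {k} _ = ℕ.m∸n≤m maxRank k

  orient-injective : ∀ b {k k′} → k ≤ maxRank → k′ ≤ maxRank → orient b k ≡ orient b k′ → k ≡ k′
  orient-injective false _ _ eq = eq
  orient-injective true k≤max k′≤max eq = ℕ.∸-cancelˡ-≡ k≤max k′≤max eq

  rank : ℕ → Fin n → ℕ
  rank E i = orient (proj₂ (schedule E)) (interleave (proj₁ (schedule E)) (toℕ i))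

  rank-≤ : ∀ E i → rank E i ≤ maxRank
  rank-≤ E i = orient-≤ (proj₂ (schedule E)) (interleave-≤ _ (toℕ<n i))

  rank-injective : ∀ E {i j} → rank E i ≡ rank E j → i ≡ j
  rank-injective E {i} {j} eq = toℕ-injective (interleave-injective _ (toℕ<n i) (toℕ<n j)
    (orient-injective (proj₂ (schedule E)) (interleave-≤ _ (toℕ<n i)) (interleave-≤ _ (toℕ<n j)) eq))

  rank-odd : ∀ m i → rank (suc (m + m)) i ≡ interleave m (toℕ i)
  rank-odd m i = cong (λ (g , b) → orient b (interleave g (toℕ i))) (schedule-odd m)

  rank-even : ∀ m i → rank (suc (suc (m + m))) i ≡ maxRank ∸ interleave m (toℕ i)
  rank-even m i = cong (λ (g , b) → orient b (interleave g (toℕ i))) (schedule-even m)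

  abstract

    slot : ℕ → Fin n → ℕ
    slot E i = radix (suc maxRank) E (rank E i)

    slot-<-level : ∀ {E E′} i j → E < E′ → slot E i < slot E′ j
    slot-<-level {E} {E′} i j = radix-<-high {h = E} {l′ = rank E′ j} (s≤s (rank-≤ E i))

    slot-<-rank : ∀ {E} i j → rank E i < rank E j → slot E i < slot E j
    slot-<-rank {E} _ _ = radix-<-low {h = E}

    slot-suc : ∀ {E} i j → rank E j ≡ suc (rank E i) → slot E j ≡ suc (slot E i)
    slot-suc {E} i j eq = trans (cong (radix (suc maxRank) E) eq) (ℕ.+-suc (E * suc maxRank) (rank E i))

    slot-injective : ∀ {E E′} i j → slot E i ≡ slot E′ j → i ≡ j
    slot-injective {E} {E′} i j eq
      with refl , ranks≡ ← radix-injective {h = E} {h′ = E′} (s≤s (rank-≤ E i)) (s≤s (rank-≤ E′ j)) eq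
      = rank-injective E ranks≡

  record Placement (s : Subset n) : Set where
    field
      e : ℕ
      e<n : e < n
      a b c : Fin n
      rank-b : rank (suc e) b ≡ suc (rank (suc e) a)
      rank-c : rank (suc e) c < rank (suc e) a
      spans : Spans s a b c

  module _ {s : Subset n} (cp : ClosePair s) where
    open ClosePair cp

    closePair-consecutive : interleave gap (toℕ q) ≡ suc (interleave gap (toℕ p))
    closePair-consecutive = trans (cong (interleave gap) q≡p+gap) (interleave-+gap gap (toℕ p))

    closePair-levels : suc (suc (gap + gap)) ≤ n
    closePair-levels = subst (_≤ n) (ℕ.+-suc (suc gap) gap) gap-small

  placement : ∀ {s} → ClosePair s → Placement s
  placement {s} cp with ℕ.<-cmp (interleave gap (toℕ r)) (interleave gap (toℕ p))
    where open ClosePair cp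
  ... | tri< r<p _ _ = record
    { e = gap + gap ; e<n = ℕ.<-trans (ℕ.n<1+n _) (closePair-levels cp) ; a = p ; b = q ; c = r
    ; rank-b = begin
        rank (suc (gap + gap)) q       ≡⟨ rank-odd gap q ⟩
        interleave gap (toℕ q)         ≡⟨ closePair-consecutive cp ⟩
        suc (interleave gap (toℕ p))   ≡⟨ cong suc (sym (rank-odd gap p)) ⟩
        suc (rank (suc (gap + gap)) p) ∎
    ; rank-c = subst₂ _<_ (sym (rank-odd gap r)) (sym (rank-odd gap p)) r<p
    ; spans = spans }
    where
    open ClosePair cp
    open ≡-Reasoning
  ... | tri≈ _ r≡p _ = ⊥-elim (r≢p (toℕ-injective (interleave-injective gap (toℕ<n r) (toℕ<n p) r≡p)))
    where open ClosePair cp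
  ... | tri> _ _ p<r = record
    { e = suc (gap + gap) ; e<n = closePair-levels cp ; a = q ; b = p ; c = r
    ; rank-b = begin
        rank E p                                     ≡⟨ rank-even gap p ⟩
        maxRank ∸ interleave gap (toℕ p)             ≡⟨ m∸n≡1+m∸[1+n] q≤max ⟩
        suc (maxRank ∸ suc (interleave gap (toℕ p))) ≡⟨ cong (λ k → suc (maxRank ∸ k))
                                                              (sym (closePair-consecutive cp)) ⟩
        suc (maxRank ∸ interleave gap (toℕ q))       ≡⟨ cong suc (sym (rank-even gap q)) ⟩
        suc (rank E q)                               ∎
    ; rank-c = subst₂ _<_ (sym (rank-even gap r)) (sym (rank-even gap q))
                 (ℕ.∸-monoʳ-< q<r (interleave-≤ gap (toℕ<n r)))
    ; spans = spans-swap spans }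
    where
    open ClosePair cp
    open ≡-Reasoning
    E = suc (suc (gap + gap))
    q≤max : suc (interleave gap (toℕ p)) ≤ maxRank
    q≤max = subst (_≤ maxRank) (closePair-consecutive cp) (interleave-≤ gap (toℕ<n q))
    q<r : interleave gap (toℕ q) < interleave gap (toℕ r)
    q<r with ℕ.m≤n⇒m<n∨m≡n (subst (_≤ interleave gap (toℕ r)) (sym (closePair-consecutive cp)) p<r)
    ... | inj₁ q<r = q<r
    ... | inj₂ q≡r = ⊥-elim (r≢q (toℕ-injective (interleave-injective gap (toℕ<n r) (toℕ<n q) (sym q≡r))))

module Paths (n : ℕ) where
  open Ranks n

  T : ℕ
  T = suc (2 ^ n)

  -- The x-tag of an independent path increases with the code of its subset and
  -- the y-tag decreases, so that two such paths cannot cross (tags-≤⇒≡).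
  xTag yTag : Subset n → Fin T
  xTag s = suc (subsetCode s)
  yTag s = suc (opposite (subsetCode s))

  xTag-injective : ∀ {s s′} → xTag s ≡ xTag s′ → s ≡ s′
  xTag-injective = subsetCode-injective ∘ Fin.suc-injective

  yTag-injective : ∀ {s s′} → yTag s ≡ yTag s′ → s ≡ s′
  yTag-injective = subsetCode-injective ∘ opposite-injective ∘ Fin.suc-injective

  tags-≤⇒≡ : ∀ {s s′} → xTag s Fin.≤ xTag s′ → yTag s Fin.≤ yTag s′ → s ≡ s′
  tags-≤⇒≡ (s≤s code≤) (s≤s opposite≤) =
    subsetCode-injective (Fin.≤-antisym code≤ (opposite-reverses-≤ opposite≤))

  private
    1<2 : 1 < 2
    1<2 = ℕ.n<1+n 1
    1<3 : 1 < 3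
    1<3 = s≤s (s≤s z≤n)
    1<4 : 1 < 4
    1<4 = s≤s (s≤s z≤n)
    2<3 : 2 < 3
    2<3 = ℕ.n<1+n 2
    2<4 : 2 < 4
    2<4 = s≤s (s≤s (s≤s z≤n))
    3<4 : 3 < 4
    3<4 = ℕ.n<1+n 3

  level : ℕ → Fin n → ℕ
  level E i = coord (slot E i) (# 2) (zero {2 ^ n})

  level-< : ∀ {E E′} i j → E < E′ → level E i < level E′ j
  level-< i j E<E′ = coord-<-slot (slot-<-level i j E<E′)

  level-injective : ∀ {E E′} i j → level E i ≡ level E′ j → i ≡ j
  level-injective i j eq = slot-injective i j (proj₁ (coord-injective eq))

  levels : Fin n → ℕ → ℕ
  levels i E = level E i

  cliquePath : Fin n → GridPath
  cliquePath i = staircasePath {rightward} (Stairs.stairs (levels i) 0 (suc n)) (s≤s (s≤s z≤n))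
    (Stairs.stairs-staircase (levels i) (λ E → level-< i i (ℕ.n<1+n E)) 0 (suc n))

  module Placed {s : Subset n} (P : Placement s) where
    open Placement P public

    slotA slotC : ℕ
    slotA = slot (suc e) a
    slotC = slot (suc e) c

    -- Clique coordinates sit at offset 2 of their slot.  The path rises along
    -- x = left across the row of a (offsets 1 to 4 of a's slot), runs along
    -- y = middle across the column of c (offsets 1 to 3 of c's slot) and rises
    -- along x = right up to offset 3 of the next slot, b's, across the row of b.
    left right bottom middle top : ℕ
    left = coord slotC (# 1) (xTag s)
    right = coord slotC (# 3) (xTag s)
    bottom = coord slotA (# 1) (yTag s)
    middle = coord slotA (# 4) (yTag s)
    top = coord (suc slotA) (# 3) (yTag s)

    left<right : left < right
    left<right = coord-<-offset 1<3

    bottom<middle : bottom < middle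
    bottom<middle = coord-<-offset 1<4

    middle<top : middle < top
    middle<top = coord-<-slot (ℕ.n<1+n slotA)

    corners : List Point
    corners = pt left bottom ∷ pt left middle ∷ pt right middle ∷ pt right top ∷ []

    path : GridPath
    path = staircasePath {upward} corners (s≤s (s≤s z≤n))
      ( (refl , ℤ.+<+ bottom<middle) , (refl , ℤ.+<+ left<right)
      , (refl , ℤ.+<+ middle<top) , tt)

    leftSide bar rightSide : Segment
    leftSide = vseg left bottom middle
    bar = hseg middle left right
    rightSide = vseg right middle top

    on-path : ∀ {p} → OnPath p path → OnSeg p leftSide ⊎ OnSeg p bar ⊎ OnSeg p rightSide
    on-path (here p∈) = inj₁ p∈
    on-path (there (here p∈)) = inj₂ (inj₁ p∈)
    on-path (there (there (here p∈))) = inj₂ (inj₂ p∈)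

    slotB≡ : slot (suc e) b ≡ suc slotA
    slotB≡ = slot-suc a b rank-b

    slotC<slotA : slotC < slotA
    slotC<slotA = slot-<-rank c a rank-c

    cliquePath-meets : ∀ i {p} → OnPath p (cliquePath i) → OnPath p path → OneOf a b c i
    cliquePath-meets i p∈clique p∈path
      with Stairs.on-stairs (levels i) 0 (suc n) p∈clique | on-path p∈path
    ... | e′ , inj₁ p∈row | inj₁ p∈left
      with _ , bottom≤ , ≤middle ← hseg-vseg-meet (level-< i i (ℕ.n<1+n e′)) bottom<middle p∈row p∈left
      = inj₁ (slot-injective i a (coord-squeeze bottom≤ ≤middle))
    ... | e′ , inj₁ p∈row | inj₂ (inj₁ p∈bar)
      with () ← coord-offset-injective (hseg-hseg-meet (level-< i i (ℕ.n<1+n e′)) left<right p∈row p∈bar)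
    ... | e′ , inj₁ p∈row | inj₂ (inj₂ p∈right)
      with _ , middle≤ , ≤top ← hseg-vseg-meet (level-< i i (ℕ.n<1+n e′)) middle<top p∈row p∈right
      = inj₂ (inj₁ (slot-injective i b (trans (coord-squeeze-suc 2<4 middle≤ ≤top) (sym slotB≡))))
    ... | e′ , inj₂ p∈column | inj₁ p∈left
      with () ← coord-offset-injective (vseg-vseg-meet (level-< i i (ℕ.n<1+n (suc e′))) bottom<middle p∈column p∈left)
    ... | e′ , inj₂ p∈column | inj₂ (inj₁ p∈bar)
      with (left≤ , ≤right) , _ ← hseg-vseg-meet left<right (level-< i i (ℕ.n<1+n (suc e′))) p∈bar p∈column
      = inj₂ (inj₂ (slot-injective i c (coord-squeeze left≤ ≤right)))
    ... | e′ , inj₂ p∈column | inj₂ (inj₂ p∈right)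
      with () ← coord-offset-injective (vseg-vseg-meet (level-< i i (ℕ.n<1+n (suc e′))) middle<top p∈column p∈right)

    private
      row-e : ∀ i → Stairs.row (levels i) e ∈ segs (pts (cliquePath i))
      row-e i = Stairs.row-∈-stairs (levels i) (suc n) z≤n (ℕ.m<n⇒m<1+n e<n)

      column-e : ∀ i → Stairs.column (levels i) e ∈ segs (pts (cliquePath i))
      column-e i = Stairs.column-∈-stairs (levels i) (suc n) z≤n (ℕ.m<n⇒m<1+n e<n)

    meets-cliquePath : ∀ i → OneOf a b c i → Intersect (cliquePath i) path
    meets-cliquePath i (inj₁ refl) =
      pt left (level (suc e) a) ,
      lose (row-e a) (on-hseg (ℕ.<⇒≤ (coord-<-slot (slot-<-level a c (ℕ.n<1+n e))))
                              (ℕ.<⇒≤ (coord-<-slot slotC<slotA))) ,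
      here (on-vseg (ℕ.<⇒≤ (coord-<-offset 1<2)) (ℕ.<⇒≤ (coord-<-offset 2<4)))
    meets-cliquePath i (inj₂ (inj₁ refl)) =
      pt right (level (suc e) b) ,
      lose (row-e b) (on-hseg (ℕ.<⇒≤ (coord-<-slot (slot-<-level b c (ℕ.n<1+n e))))
                              (ℕ.<⇒≤ (coord-<-slot slotC<slotB))) ,
      there (there (here (on-vseg (ℕ.<⇒≤ (coord-<-slot slotA<slotB))
                                  (subst (λ sl → coord sl (# 2) zero ≤ top) (sym slotB≡)
                                         (ℕ.<⇒≤ (coord-<-offset 2<3))))))
      where
      slotA<slotB : slotA < slot (suc e) b
      slotA<slotB = subst (slotA <_) (sym slotB≡) (ℕ.n<1+n slotA)
      slotC<slotB : slotC < slot (suc e) b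
      slotC<slotB = ℕ.<-trans slotC<slotA slotA<slotB
    meets-cliquePath i (inj₂ (inj₂ refl)) =
      pt (level (suc e) c) middle ,
      lose (column-e c) (on-vseg (ℕ.<⇒≤ (coord-<-slot slotC<slotA))
                                 (ℕ.<⇒≤ (coord-<-slot (slot-<-level a c (ℕ.n<1+n (suc e)))))) ,
      there (here (on-hseg (ℕ.<⇒≤ (coord-<-offset 1<2)) (ℕ.<⇒≤ (coord-<-offset 2<3))))

  module _ {s s′ : Subset n} (P : Placement s) (P′ : Placement s′) where
    private
      module A = Placed P
      module B = Placed P′

    leftSide-meets-bar : ∀ {p} → OnSeg p A.leftSide → OnSeg p B.bar → s′ ≡ s
    leftSide-meets-bar p∈left p∈bar
      with (left≤ , ≤right) , (bottom≤ , ≤middle) ← hseg-vseg-meet B.left<right A.bottom<middle p∈bar p∈left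
      = tags-≤⇒≡
          (coord-tag-≤ (subst (λ sl → coord B.slotC (# 1) (xTag s′) ≤ coord sl (# 1) (xTag s))
                              ((A.slotC ≡ B.slotC) ∋ (coord-squeeze left≤ ≤right)) left≤))
          (coord-tag-≤ (subst (λ sl → coord sl (# 4) (yTag s′) ≤ coord A.slotA (# 4) (yTag s))
                              ((B.slotA ≡ A.slotA) ∋ (coord-squeeze bottom≤ ≤middle)) ≤middle))

    rightSide-meets-bar : ∀ {p} → OnSeg p A.rightSide → OnSeg p B.bar → s ≡ s′
    rightSide-meets-bar p∈right p∈bar
      with (left≤ , ≤right) , (middle≤ , ≤top) ← hseg-vseg-meet B.left<right A.middle<top p∈bar p∈right
      = tags-≤⇒≡
          (coord-tag-≤ (subst (λ sl → coord sl (# 3) (xTag s) ≤ coord B.slotC (# 3) (xTag s′))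
                              ((A.slotC ≡ B.slotC) ∋ (coord-squeeze left≤ ≤right)) ≤right))
          (coord-tag-≤ (subst (λ sl → coord A.slotA (# 4) (yTag s) ≤ coord sl (# 4) (yTag s′))
                              ((B.slotA ≡ A.slotA) ∋ (coord-squeeze-low 3<4 middle≤ ≤top)) middle≤))

    vertical-sides-meet : ∀ {p} → OnSeg p A.leftSide ⊎ OnSeg p A.rightSide →
                          OnSeg p B.leftSide ⊎ OnSeg p B.rightSide → s ≡ s′
    vertical-sides-meet p∈A p∈B = xTag-injective (xTags p∈A p∈B)
      where
      xTags : ∀ {p} → OnSeg p A.leftSide ⊎ OnSeg p A.rightSide →
              OnSeg p B.leftSide ⊎ OnSeg p B.rightSide → xTag s ≡ xTag s′
      xTags (inj₁ l) (inj₁ l′) = coord-tag-injective (vseg-vseg-meet A.bottom<middle B.bottom<middle l l′)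
      xTags (inj₁ l) (inj₂ r′) = coord-tag-injective (vseg-vseg-meet A.bottom<middle B.middle<top l r′)
      xTags (inj₂ r) (inj₁ l′) = coord-tag-injective (vseg-vseg-meet A.middle<top B.bottom<middle r l′)
      xTags (inj₂ r) (inj₂ r′) = coord-tag-injective (vseg-vseg-meet A.middle<top B.middle<top r r′)

    bars-meet : ∀ {p} → OnSeg p A.bar → OnSeg p B.bar → s ≡ s′
    bars-meet p∈ p∈′ = yTag-injective (coord-tag-injective (hseg-hseg-meet A.left<right B.left<right p∈ p∈′))

  placedPaths-meet : ∀ {s s′} (P : Placement s) (P′ : Placement s′) {p} →
    OnPath p (Placed.path P) → OnPath p (Placed.path P′) → s ≡ s′
  placedPaths-meet P P′ p∈ p∈′ with Placed.on-path P p∈ | Placed.on-path P′ p∈′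
  ... | inj₂ (inj₁ bar) | inj₂ (inj₁ bar′) = bars-meet P P′ bar bar′
  ... | inj₁ left | inj₂ (inj₁ bar′) = sym (leftSide-meets-bar P P′ left bar′)
  ... | inj₂ (inj₂ right) | inj₂ (inj₁ bar′) = rightSide-meets-bar P P′ right bar′
  ... | inj₂ (inj₁ bar) | inj₁ left′ = leftSide-meets-bar P′ P left′ bar
  ... | inj₂ (inj₁ bar) | inj₂ (inj₂ right′) = sym (rightSide-meets-bar P′ P right′ bar)
  ... | inj₁ left | inj₁ left′ = vertical-sides-meet P P′ (inj₁ left) (inj₁ left′)
  ... | inj₁ left | inj₂ (inj₂ right′) = vertical-sides-meet P P′ (inj₁ left) (inj₂ right′)
  ... | inj₂ (inj₂ right) | inj₁ left′ = vertical-sides-meet P P′ (inj₂ right) (inj₁ left′)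
  ... | inj₂ (inj₂ right) | inj₂ (inj₂ right′) = vertical-sides-meet P P′ (inj₂ right) (inj₂ right′)

  cliquePaths-meet : ∀ {i j} → level 1 i < level 1 j → Intersect (cliquePath i) (cliquePath j)
  cliquePaths-meet {i} {j} i<j =
    pt (level 1 i) (level 1 j) ,
    lose (Stairs.column-∈-stairs (levels i) (suc n) z≤n (s≤s z≤n))
         (on-vseg (ℕ.<⇒≤ i<j) (ℕ.<⇒≤ (level-< j i (ℕ.n<1+n 1)))) ,
    lose (Stairs.row-∈-stairs (levels j) (suc n) z≤n (s≤s z≤n))
         (on-hseg (ℕ.<⇒≤ (level-< j i (ℕ.n<1+n 0))) (ℕ.<⇒≤ i<j))

  cliquePaths-intersect : ∀ {i j} → i ≢ j → Intersect (cliquePath i) (cliquePath j)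
  cliquePaths-intersect {i} {j} i≢j with ℕ.<-cmp (level 1 i) (level 1 j)
  ... | tri< i<j _ _ = cliquePaths-meet i<j
  ... | tri≈ _ i≡j _ = ⊥-elim (i≢j (level-injective i j i≡j))
  ... | tri> _ _ j<i = intersect-sym {cliquePath j} {cliquePath i} (cliquePaths-meet j<i)

  CliqueCoordinate : Fin n → ℤ → Set
  CliqueCoordinate i v = ∃ λ E → v ≡ + level E i

  PlacedCoordinate : Fin T → ℤ → Set
  PlacedCoordinate t v = ∃₂ λ sl o → o ≢ # 2 × v ≡ + coord sl o t

  cliquePath-cornerXs : ∀ i {x} → x ∈ cornerXs (cliquePath i) → CliqueCoordinate i x
  cliquePath-cornerXs i x∈ with _ , q∈ , refl ← ∈-map⁻ X x∈ =
    proj₁ (Stairs.stairs-corners (levels i) 0 (suc n) q∈)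

  cliquePath-cornerYs : ∀ i {y} → y ∈ cornerYs (cliquePath i) → CliqueCoordinate i y
  cliquePath-cornerYs i y∈ with _ , q∈ , refl ← ∈-map⁻ Y y∈ =
    proj₂ (Stairs.stairs-corners (levels i) 0 (suc n) q∈)

  placedPath-cornerXs : ∀ {s} (P : Placement s) {x} → x ∈ cornerXs (Placed.path P) →
                        PlacedCoordinate (xTag s) x
  placedPath-cornerXs P (here refl) = Placed.slotC P , # 1 , (λ ()) , refl
  placedPath-cornerXs P (there (here refl)) = Placed.slotC P , # 1 , (λ ()) , refl
  placedPath-cornerXs P (there (there (here refl))) = Placed.slotC P , # 3 , (λ ()) , refl
  placedPath-cornerXs P (there (there (there (here refl)))) = Placed.slotC P , # 3 , (λ ()) , refl

  placedPath-cornerYs : ∀ {s} (P : Placement s) {y} → y ∈ cornerYs (Placed.path P) →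
                        PlacedCoordinate (yTag s) y
  placedPath-cornerYs P (here refl) = Placed.slotA P , # 1 , (λ ()) , refl
  placedPath-cornerYs P (there (here refl)) = Placed.slotA P , # 4 , (λ ()) , refl
  placedPath-cornerYs P (there (there (here refl))) = Placed.slotA P , # 4 , (λ ()) , refl
  placedPath-cornerYs P (there (there (there (here refl)))) = suc (Placed.slotA P) , # 3 , (λ ()) , refl

  cliqueCoordinate-unique : ∀ {i j v} → CliqueCoordinate i v → CliqueCoordinate j v → i ≡ j
  cliqueCoordinate-unique {i} {j} (_ , refl) (_ , eq) = level-injective i j (ℤ.+-injective eq)

  clique-placed-coordinates : ∀ {i t v} → CliqueCoordinate i v → PlacedCoordinate t v → ⊥
  clique-placed-coordinates (_ , refl) (_ , _ , o≢2 , eq) =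
    o≢2 (sym (coord-offset-injective (ℤ.+-injective eq)))

  placedCoordinate-tag : ∀ {t t′ v} → PlacedCoordinate t v → PlacedCoordinate t′ v → t ≡ t′
  placedCoordinate-tag (_ , _ , _ , refl) (_ , _ , _ , eq) =
    coord-tag-injective (ℤ.+-injective eq)

  cliquePaths-disjoint : ∀ {i j} → i ≢ j → DisjointCorners (cliquePath i) (cliquePath j)
  cliquePaths-disjoint {i} {j} i≢j =
    (λ x∈ x∈′ → i≢j (cliqueCoordinate-unique (cliquePath-cornerXs i x∈) (cliquePath-cornerXs j x∈′))) ,
    (λ y∈ y∈′ → i≢j (cliqueCoordinate-unique (cliquePath-cornerYs i y∈) (cliquePath-cornerYs j y∈′)))

  clique-placed-disjoint : ∀ i {s} (P : Placement s) → DisjointCorners (cliquePath i) (Placed.path P)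
  clique-placed-disjoint i P =
    (λ x∈ x∈′ → clique-placed-coordinates (cliquePath-cornerXs i x∈) (placedPath-cornerXs P x∈′)) ,
    (λ y∈ y∈′ → clique-placed-coordinates (cliquePath-cornerYs i y∈) (placedPath-cornerYs P y∈′))

  placedPaths-disjoint : ∀ {s s′} (P : Placement s) (P′ : Placement s′) → s ≢ s′ →
                         DisjointCorners (Placed.path P) (Placed.path P′)
  placedPaths-disjoint P P′ s≢s′ =
    (λ x∈ x∈′ → s≢s′ (xTag-injective
      (placedCoordinate-tag (placedPath-cornerXs P x∈) (placedPath-cornerXs P′ x∈′)))) ,
    (λ y∈ y∈′ → s≢s′ (yTag-injective
      (placedCoordinate-tag (placedPath-cornerYs P y∈) (placedPath-cornerYs P′ y∈′))))

[1+n]+[1+n]+3≡2*n+4+1 : ∀ n → suc n + suc n + 3 ≡ 2 * n + 4 + 1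
[1+n]+[1+n]+3≡2*n+4+1 = solve-∀

module Representation (n : ℕ) where
  open Ranks n
  open Paths n

  placementOf : (s : Subset n) → ∣ s ∣ ≡ 3 → Placement s
  placementOf s ∣s∣≡3 = placement (closePair (triple s ∣s∣≡3))

  vertexPath : KV 3 n → GridPath
  vertexPath (inj₁ i) = cliquePath i
  vertexPath (inj₂ (s , ∣s∣≡3)) = Placed.path (placementOf s ∣s∣≡3)

  independent-≡ : ∀ {s s′ : Subset n} {h : ∣ s ∣ ≡ 3} {h′ : ∣ s′ ∣ ≡ 3} →
                  s ≡ s′ → _≡_ {A = KV 3 n} (inj₂ (s , h)) (inj₂ (s′ , h′))
  independent-≡ {s} {h = h} {h′} refl = cong (λ h → inj₂ (s , h)) (ℕ.≡-irrelevant h h′)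

  vertexPaths-disjoint : ∀ u v → u ≢ v → DisjointCorners (vertexPath u) (vertexPath v)
  vertexPaths-disjoint (inj₁ i) (inj₁ j) u≢v = cliquePaths-disjoint (u≢v ∘ cong inj₁)
  vertexPaths-disjoint (inj₁ i) (inj₂ (s , h)) _ = clique-placed-disjoint i (placementOf s h)
  vertexPaths-disjoint (inj₂ (s , h)) (inj₁ i) _ =
    disjointCorners-sym {cliquePath i} {Placed.path (placementOf s h)}
      (clique-placed-disjoint i (placementOf s h))
  vertexPaths-disjoint (inj₂ (s , h)) (inj₂ (s′ , h′)) u≢v =
    placedPaths-disjoint (placementOf s h) (placementOf s′ h′) (u≢v ∘ independent-≡)

  intersect⇒adjacent : ∀ u v → u ≢ v → Intersect (vertexPath u) (vertexPath v) → KAdj 3 n u v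
  intersect⇒adjacent (inj₁ i) (inj₁ j) u≢v _ = u≢v ∘ cong inj₁
  intersect⇒adjacent (inj₁ i) (inj₂ (s , h)) _ (_ , p∈i , p∈s) =
    proj₂ (Placed.spans P i) (Placed.cliquePath-meets P i p∈i p∈s)
    where P = placementOf s h
  intersect⇒adjacent (inj₂ (s , h)) (inj₁ i) _ (_ , p∈s , p∈i) =
    proj₂ (Placed.spans P i) (Placed.cliquePath-meets P i p∈i p∈s)
    where P = placementOf s h
  intersect⇒adjacent (inj₂ (s , h)) (inj₂ (s′ , h′)) u≢v (_ , p∈s , p∈s′) =
    u≢v (independent-≡ (placedPaths-meet (placementOf s h) (placementOf s′ h′) p∈s p∈s′))

  adjacent⇒intersect : ∀ u v → u ≢ v → KAdj 3 n u v → Intersect (vertexPath u) (vertexPath v)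
  adjacent⇒intersect (inj₁ i) (inj₁ j) _ i≢j = cliquePaths-intersect i≢j
  adjacent⇒intersect (inj₁ i) (inj₂ (s , h)) _ i∈s =
    Placed.meets-cliquePath P i (proj₁ (Placed.spans P i) i∈s)
    where P = placementOf s h
  adjacent⇒intersect (inj₂ (s , h)) (inj₁ i) _ i∈s =
    intersect-sym {cliquePath i} {Placed.path P}
      (Placed.meets-cliquePath P i (proj₁ (Placed.spans P i) i∈s))
    where P = placementOf s h

  vertexPath-bends : ∀ v → IsKBend (2 * n + 4) (vertexPath v)
  vertexPath-bends v = ℕ.≤-trans (segments≤ v) (ℕ.≤-reflexive ([1+n]+[1+n]+3≡2*n+4+1 n))
    where
    segments≤ : ∀ v → nSegs (vertexPath v) ≤ suc n + suc n + 3
    segments≤ (inj₁ i) = ℕ.≤-trans (ℕ.≤-reflexive (Stairs.length-segs-stairs (levels i) 0 (suc n)))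
                                  (ℕ.m≤m+n _ 3)
    segments≤ (inj₂ _) = ℕ.m≤n+m 3 (suc n + suc n)

  representation : BendP≤ (K 3 n) (2 * n + 4)
  representation = record
    { path = vertexPath
    ; kBend = vertexPath-bends
    ; intersect⇒adj = intersect⇒adjacent
    ; adj⇒intersect = adjacent⇒intersect
    ; finiteIntersections = λ u v u≢v → _ , λ _ →
        disjointCorners-finite {vertexPath u} {vertexPath v} (vertexPaths-disjoint u v u≢v)
    ; exactlyTwo = λ u v w _ u≢v u≢w v≢w →
        disjointCorners-no-triple {vertexPath u} {vertexPath v} {vertexPath w}
        (vertexPaths-disjoint u v u≢v) (vertexPaths-disjoint u w u≢w) (vertexPaths-disjoint v w v≢w)
    ; crossing = λ u v _ u≢v →
        disjointCorners-crossing {vertexPath u} {vertexPath v} (vertexPaths-disjoint u v u≢v)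
    }

lemma5 : (n : ℕ) → 3 ≤ n → BendP≤ (K 3 n) (2 * n + 4)
-- The construction needs no lower bound on n.
lemma5 n _ = Representation.representation n
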